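{- Let $\pi\in\mathbf I_n(3412)$ and $\Psi(\pi)=d_1\cdots d_n$. For $1\le i\le n-1$, $\pi$ has a descent at position $i$ (i.e. $\pi_i>\pi_{i+1}$) if and only if $d_id_{i+1}\in\{UU,DD,UH,HD,UD\}$. Thus the descents of $\pi$ correspond bijectively to the occurrences in $\Psi(\pi)$ of the consecutive subwords $UU,DD,UH,HD,UD$.
   Context: $\mathbf I_n(3412)$ is the set of involutions of $\{1,\dots,n\}$ with no subsequence order-isomorphic to $3412$. For an involution $\pi$, $\Psi(\pi)$ is the Motzkin path $d_1\cdots d_n$ (steps $U=(1,1)$, $D=(1,-1)$, $H=(1,0)$) with $d_i=H$ if $i$ is a fixed point of $\pi$, $d_i=U$ if $i$ is the smaller element of a 2-cycle, $d_i=D$ if $i$ is the larger element of a 2-cycle. -}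

module Defs where

open import Data.Nat using (ℕ)
open import Data.Fin using (Fin; _<_)
open import Data.Fin.Properties using (<-cmp)
open import Data.Product using (_×_; _,_)
open import Data.List using (List; _∷_; [])
open import Relation.Binary.PropositionalEquality using (_≡_)
open import Relation.Binary.Definitions using (tri<; tri≈; tri>)
open import Relation.Nullary using (¬_)

-- A permutation of {1..n} is modelled as a map Fin n → Fin n (positions and
-- values are 0-indexed).  An involution is a map with π (π i) = i, which is
-- automatically a bijection.
IsInvolution : {n : ℕ} → (Fin n → Fin n) → Set
IsInvolution π = ∀ i → π (π i) ≡ i

Contains3412 : {n : ℕ} → (Fin n → Fin n) → Set
Contains3412 {n} π =
  Data.Product.∃ λ (a : Fin n) → Data.Product.∃ λ (b : Fin n) →
  Data.Product.∃ λ (c : Fin n) → Data.Product.∃ λ (d : Fin n) →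
  (a < b) × (b < c) × (c < d) × (π c < π d) × (π d < π a) × (π a < π b)

Avoids3412 : {n : ℕ} → (Fin n → Fin n) → Set
Avoids3412 π = ¬ Contains3412 π

data Step : Set where
  U D H : Step

Ψ : {n : ℕ} → (Fin n → Fin n) → Fin n → Step
Ψ π i with <-cmp i (π i)
... | tri< _ _ _ = U
... | tri≈ _ _ _ = H
... | tri> _ _ _ = D

descentWords : List (Step × Step)
descentWords = (U , U) ∷ (D , D) ∷ (U , H) ∷ (H , D) ∷ (U , D) ∷ []

module Submission where

-- The theorem then splits
-- into two directions over the nine possible step pairs.
--   * HH, HU, DU and DH are ascents, since there π i ≤ i < j ≤ π j.
--   * The five descent words are descents.  Adjacency says that a value above
--     i is at least j and a value below j is at most i; the boundary values
--     are excluded because π i = j forces π j = i.  This settles UD, UH and HD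
--     directly.  For UU and DD it puts i, j, π i, π j in the relative order
--     of a 3412 pattern as soon as π i < π j, so 3412-avoidance gives the
--     descent.
-- Only the UU and DD cases use 3412-avoidance; all other cases use just that
-- π is an involution and that i and j are adjacent.

open import Defs
open import Data.Nat using (ℕ; suc; s≤s⁻¹) renaming (_≤_ to _≤ℕ_)
import Data.Nat.Properties as ℕ
open import Data.Fin using (Fin; toℕ; _<_; _≤_)
open import Data.Fin.Properties using (<-cmp; <-asym; <-irrefl; <⇒≢; ≤-reflexive; ≤∧≢⇒<)
open import Data.Product using (_,_)
open import Data.List.Membership.Propositional using (_∈_)
open import Data.List.Relation.Unary.Any using (here; there)
open import Relation.Binary.PropositionalEquality using (_≡_; _≢_; refl; sym; trans; cong; subst; subst₂)
open import Relation.Nullary using (¬_)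
open import Relation.Binary.Definitions using (tri<; tri≈; tri>)
open import Data.Empty using (⊥-elim)
open import Function.Bundles using (_⇔_; mk⇔)

Shape : {n : ℕ} → (Fin n → Fin n) → Fin n → Step → Set
Shape π i U = i < π i
Shape π i H = π i ≡ i
Shape π i D = π i < i

Ψ-shape : {n : ℕ} (π : Fin n → Fin n) (i : Fin n) → Shape π i (Ψ π i)
Ψ-shape π i with <-cmp i (π i)
... | tri< i<πi _ _ = i<πi
... | tri≈ _ i≡πi _ = sym i≡πi
... | tri> _ _ πi<i = πi<i

involution-swap : {n : ℕ} {π : Fin n → Fin n} → IsInvolution π →
                  {x y : Fin n} → π x ≡ y → π y ≡ x
involution-swap {π = π} inv {x} πx≡y = trans (cong π (sym πx≡y)) (inv x)

involution-injective : {n : ℕ} {π : Fin n → Fin n} → IsInvolution π →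
                       {x y : Fin n} → π x ≡ π y → x ≡ y
involution-injective {π = π} inv {x} {y} πx≡πy =
  trans (sym (inv x)) (trans (cong π πx≡πy) (inv y))

descent-unless-ascent : {n : ℕ} {π : Fin n → Fin n} → IsInvolution π →
                        {i j : Fin n} → i < j → ¬ (π i < π j) → π j < π i
descent-unless-ascent {π = π} inv {i} {j} i<j no-ascent with <-cmp (π i) (π j)
... | tri< πi<πj _ _ = ⊥-elim (no-ascent πi<πj)
... | tri≈ _ πi≡πj _ = ⊥-elim (<⇒≢ i<j (involution-injective inv πi≡πj))
... | tri> _ _ πj<πi = πj<πi

Adjacent : {n : ℕ} → Fin n → Fin n → Set
Adjacent i j = toℕ j ≡ suc (toℕ i)

module _ {n : ℕ} {π : Fin n → Fin n} (inv : IsInvolution π)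
         {i j : Fin n} (adj : Adjacent i j) where

  adjacent-< : i < j
  adjacent-< = ℕ.≤-reflexive (sym adj)

  below-next : {k : Fin n} → k < j → k ≤ i
  below-next k<j = s≤s⁻¹ (subst (suc (toℕ _) ≤ℕ_) adj k<j)

  above-prev : {k : Fin n} → i < k → j ≤ k
  above-prev i<k = subst (_≤ℕ toℕ _) (sym adj) i<k

  rising-next-is-no-partner : j ≤ π j → π i ≢ j
  rising-next-is-no-partner j≤πj πi≡j =
    <-irrefl (sym (involution-swap inv πi≡j)) (ℕ.<-≤-trans adjacent-< j≤πj)

  falling-prev-is-no-partner : π i ≤ i → π i ≢ j
  falling-prev-is-no-partner πi≤i πi≡j = <-irrefl πi≡j (ℕ.≤-<-trans πi≤i adjacent-<)

  up-passes-next : i < π i → j ≤ π j → j < π i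
  up-passes-next i<πi j≤πj =
    ≤∧≢⇒< (above-prev i<πi) (λ j≡πi → rising-next-is-no-partner j≤πj (sym j≡πi))

  down-passes-prev : π j < j → π i ≤ i → π j < i
  down-passes-prev πj<j πi≤i =
    ≤∧≢⇒< (below-next πj<j)
          (λ πj≡i → falling-prev-is-no-partner πi≤i (involution-swap inv πj≡i))

  ascent : π i ≤ i → j ≤ π j → π i < π j
  ascent πi≤i j≤πj = ℕ.≤-<-trans πi≤i (ℕ.<-≤-trans adjacent-< j≤πj)

  -- UU: if π i < π j then i < j < π i < π j is an occurrence of 3412.
  up-up-descent : Avoids3412 π → i < π i → j < π j → π j < π i
  up-up-descent av i<πi j<πj = descent-unless-ascent inv adjacent-< no-ascent
    where
    j<πi : j < π i
    j<πi = up-passes-next i<πi (ℕ.<⇒≤ j<πj)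
    no-ascent : ¬ (π i < π j)
    no-ascent πi<πj = av (i , j , π i , π j , adjacent-< , j<πi , πi<πj ,
                   subst₂ _<_ (sym (inv i)) (sym (inv j)) adjacent-< ,
                   subst (_< π i) (sym (inv j)) j<πi , πi<πj)

  -- DD: if π i < π j then π i < π j < i < j is an occurrence of 3412.
  down-down-descent : Avoids3412 π → π i < i → π j < j → π j < π i
  down-down-descent av πi<i πj<j = descent-unless-ascent inv adjacent-< no-ascent
    where
    πj<i : π j < i
    πj<i = down-passes-prev πj<j (ℕ.<⇒≤ πi<i)
    no-ascent : ¬ (π i < π j)
    no-ascent πi<πj = av (π i , π j , i , j , πi<πj , πj<i , adjacent-< , πi<πj ,
                   subst (π j <_) (sym (inv i)) πj<i ,
                   subst₂ _<_ (sym (inv i)) (sym (inv j)) adjacent-<)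

  word⇒descent : Avoids3412 π → {s t : Step} → (s , t) ∈ descentWords →
                 Shape π i s → Shape π j t → π j < π i
  word⇒descent av (here refl) i<πi j<πj = up-up-descent av i<πi j<πj
  word⇒descent av (there (here refl)) πi<i πj<j = down-down-descent av πi<i πj<j
  word⇒descent av (there (there (here refl))) i<πi πj≡j =
    subst (_< π i) (sym πj≡j) (up-passes-next i<πi (≤-reflexive (sym πj≡j)))
  word⇒descent av (there (there (there (here refl)))) πi≡i πj<j =
    subst (π j <_) (sym πi≡i) (down-passes-prev πj<j (≤-reflexive πi≡i))
  word⇒descent av (there (there (there (there (here refl))))) i<πi πj<j =
    ℕ.≤-<-trans (below-next πj<j) i<πi

  descent⇒word : {s t : Step} → Shape π i s → Shape π j t →
                 π j < π i → (s , t) ∈ descentWords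
  descent⇒word {U} {U} _ _ _ = here refl
  descent⇒word {D} {D} _ _ _ = there (here refl)
  descent⇒word {U} {H} _ _ _ = there (there (here refl))
  descent⇒word {H} {D} _ _ _ = there (there (there (here refl)))
  descent⇒word {U} {D} _ _ _ = there (there (there (there (here refl))))
  descent⇒word {H} {H} πi≡i πj≡j desc =
    ⊥-elim (<-asym desc (ascent (≤-reflexive πi≡i) (≤-reflexive (sym πj≡j))))
  descent⇒word {H} {U} πi≡i j<πj desc =
    ⊥-elim (<-asym desc (ascent (≤-reflexive πi≡i) (ℕ.<⇒≤ j<πj)))
  descent⇒word {D} {U} πi<i j<πj desc =
    ⊥-elim (<-asym desc (ascent (ℕ.<⇒≤ πi<i) (ℕ.<⇒≤ j<πj)))
  descent⇒word {D} {H} πi<i πj≡j desc =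
    ⊥-elim (<-asym desc (ascent (ℕ.<⇒≤ πi<i) (≤-reflexive (sym πj≡j))))

lemma3p2 : (n : ℕ) (π : Fin n → Fin n) → IsInvolution π → Avoids3412 π →
    (i j : Fin n) → toℕ j ≡ suc (toℕ i) →
    (π j < π i) ⇔ ((Ψ π i , Ψ π j) ∈ descentWords)
lemma3p2 n π inv av i j adj =
  mk⇔ (descent⇒word inv adj (Ψ-shape π i) (Ψ-shape π j))
      (λ word → word⇒descent inv adj av word (Ψ-shape π i) (Ψ-shape π j))
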